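{- Let $n\geq 5$. Let $S_n^+$ be the graph obtained from the star $S_n$ on $n$ vertices by adding one new edge (between two nonadjacent vertices), and let $S_n^{++}$ be any graph obtained from $S_n^+$ by adding one further new edge (between two nonadjacent vertices). Then $px_k(S_n^{++})\leq n-3$ for each integer $k$ with $3\leq k\leq n$.
   Context: All graphs are finite, simple, undirected and connected. An edge-coloring of a graph $G$ assigns colors to edges (adjacent edges may receive the same color). A tree in an edge-colored graph is a proper tree if any two adjacent edges of it receive different colors. For $S\subseteq V(G)$, an $S$-tree is a tree in $G$ containing all vertices of $S$. For a graph $G$ of order $n$ and an integer $k$ with $2\leq k\leq n$, an edge-coloring of $G$ is a $k$-proper coloring if for every set $S$ of $k$ vertices of $G$ there is a proper $S$-tree in $G$. The $k$-proper index $px_k(G)$ of a nontrivial connected graph $G$ is the smallest number of colors in a $k$-proper coloring of $G$. -}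

module Defs where

open import Level using (0ℓ)
open import Data.Nat using (ℕ; _≤_; _∸_)
open import Data.Fin using (Fin)
open import Data.Fin.Subset using (Subset; _∈_; ∣_∣)
open import Data.List using (List; length; take; _++_)
open import Data.List.Relation.Unary.Unique.Propositional using (Unique)
open import Data.List.Relation.Unary.Linked using (Linked)
open import Data.Product using (Σ; _×_)
open import Data.Sum using (_⊎_)
open import Relation.Nullary using (¬_)
open import Relation.Binary.PropositionalEquality using (_≡_; _≢_)

-- A graph on vertex set Fin n is given by its (symmetric, irreflexive) adjacency relation.
Rel : ℕ → Set₁
Rel n = Fin n → Fin n → Set

data Walk {n : ℕ} (R : Rel n) : Fin n → Fin n → Set where
  here : ∀ {x} → Walk R x x
  step : ∀ {x y z} → R x y → Walk R y z → Walk R x z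

IsCycle : {n : ℕ} → Rel n → List (Fin n) → Set
IsCycle R xs = Unique xs × (3 ≤ length xs) × Linked R (xs ++ take 1 xs)

record Tree {n : ℕ} (G : Rel n) : Set₁ where
  field
    V         : Fin n → Set
    E         : Rel n
    E-sub     : ∀ {u v} → E u v → G u v
    E-sym     : ∀ {u v} → E u v → E v u
    E-V       : ∀ {u v} → E u v → V u × V v
    connected : ∀ {u v} → V u → V v → Walk E u v
    acyclic   : ∀ xs → ¬ IsCycle E xs

-- An edge-colouring with m colours: a symmetric function on vertex pairs
-- (only its values on edges matter).
record EdgeColouring (n m : ℕ) : Set where
  field
    col     : Fin n → Fin n → Fin m
    col-sym : ∀ u v → col u v ≡ col v u
open EdgeColouring public

ProperTree : {n m : ℕ} {G : Rel n} → EdgeColouring n m → Tree G → Set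
ProperTree c T = ∀ u v w → E u v → E v w → u ≢ w → col c u v ≢ col c v w
  where open Tree T

IsSTree : {n : ℕ} {G : Rel n} → Subset n → Tree G → Set
IsSTree S T = ∀ v → v ∈ S → Tree.V T v

KProper : {n m : ℕ} → Rel n → ℕ → EdgeColouring n m → Set₁
KProper {n} G k c = ∀ (S : Subset n) → ∣ S ∣ ≡ k →
  Σ (Tree G) λ T → IsSTree S T × ProperTree c T

-- px_k(G) ≤ m  iff  G has a k-proper colouring using (at most) m colours.
pxk≤ : {n : ℕ} → Rel n → ℕ → ℕ → Set₁
pxk≤ {n} G k m = Σ (EdgeColouring n m) λ c → KProper G k c

-- Star with centre z, plus edges {a,b} and {c,d} (a,b,c,d leaves).
SPP : {n : ℕ} → (z a b c d : Fin n) → Rel n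
SPP z a b c d u v =
  (u ≡ z × v ≢ z) ⊎ (v ≡ z × u ≢ z) ⊎
  (u ≡ a × v ≡ b) ⊎ (u ≡ b × v ≡ a) ⊎
  (u ≡ c × v ≡ d) ⊎ (u ≡ d × v ≡ c)

-- Root a spanning tree of the graph at the centre z: every leaf hangs from z
-- except s₁ and s₂, which hang below neighbours t₁ and t₂ along the two added
-- edges.  If each tree edge is coloured by a label of its endpoint farther from
-- the root, the tree is proper as soon as labels differ between a child and its
-- non-root parent and among siblings.  The n − 3 children of z take pairwise
-- distinct colours, and s₁, then s₂, take a colour different from their
-- parent's.  A proper spanning tree is a proper S-tree for every S, so this one
-- colouring works for every k.
module Submission where

open import Defs
open import Data.Nat using (ℕ; suc; _+_; _≤_; _<_; _∸_; s≤s; z≤n; _<?_)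
open import Data.Nat.Properties using (<-asym; <-irrefl; <-trans; <-≤-trans; ≤-refl; ≤-reflexive)
open import Data.Fin using (Fin; punchOut) renaming (zero to fzero; suc to fsuc)
open import Data.Fin.Properties using (_≟_; punchOut-injective)
open import Data.Vec.Functional using (updateAt)
open import Data.Vec.Functional.Properties using (updateAt-updates; updateAt-minimal)
open import Data.List using (List; []; _∷_; _∷ʳ_)
open import Data.List.Relation.Unary.All using (All; []; _∷_)
open import Data.List.Relation.Unary.All.Properties using (All¬⇒¬Any; ∷ʳ⁻)
open import Data.List.Relation.Unary.AllPairs as AllPairs using ([]; _∷_)
open import Data.List.Relation.Unary.Any as Any using (Any; here; there)
open import Data.List.Relation.Unary.Linked as Linked using (Linked; []; [-]; _∷_)
open import Data.List.Relation.Unary.Linked.Properties using (Linked⇒AllPairs)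
open import Data.List.Relation.Unary.Unique.Propositional using (Unique)
open import Data.List.Relation.Unary.Unique.Propositional.Properties using (++⁺)
open import Data.Product using (_×_; _,_; proj₂)
open import Data.Sum using (_⊎_; inj₁; inj₂; swap)
open import Data.Unit using (⊤; tt)
open import Data.Empty using (⊥-elim)
open import Function using (_∘_; flip)
open import Relation.Nullary using (¬_; yes; no; contradiction)
open import Relation.Binary.PropositionalEquality using (_≡_; _≢_; refl; sym; trans; cong; ≢-sym; module ≡-Reasoning)

properSpanningTree⇒pxk≤ : ∀ {n m} {G : Rel n} (c : EdgeColouring n m) (T : Tree G) →
  (∀ v → Tree.V T v) → ProperTree c T → ∀ k → pxk≤ G k m
properSpanningTree⇒pxk≤ c T spans proper k = c , λ S _ → T , (λ v _ → spans v) , proper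

module _ {n : ℕ} {R : Rel n} where

  _◅◅_ : ∀ {x y w} → Walk R x y → Walk R y w → Walk R x w
  here ◅◅ q = q
  step e p ◅◅ q = step e (p ◅◅ q)

  reverse : (∀ {u v} → R u v → R v u) → ∀ {x y} → Walk R x y → Walk R y x
  reverse R-sym here = here
  reverse R-sym (step e p) = reverse R-sym p ◅◅ step (R-sym e) here

module _ {A : Set} where

  data NonBacktracking : List A → Set where
    []    : NonBacktracking []
    [-]   : ∀ {x} → NonBacktracking (x ∷ [])
    [-,-] : ∀ {x y} → NonBacktracking (x ∷ y ∷ [])
    _∷_   : ∀ {x y z l} → x ≢ z → NonBacktracking (y ∷ z ∷ l) → NonBacktracking (x ∷ y ∷ z ∷ l)

  tail : ∀ {x l} → NonBacktracking (x ∷ l) → NonBacktracking l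
  tail [-] = []
  tail [-,-] = [-]
  tail (_ ∷ nb) = nb

  Unique⇒NonBacktracking : ∀ {l} → Unique l → NonBacktracking l
  Unique⇒NonBacktracking {[]} _ = []
  Unique⇒NonBacktracking {_ ∷ []} _ = [-]
  Unique⇒NonBacktracking {_ ∷ _ ∷ []} _ = [-,-]
  Unique⇒NonBacktracking {_ ∷ _ ∷ _ ∷ _} ((_ ∷ x≢z ∷ _) ∷ u) = x≢z ∷ Unique⇒NonBacktracking u

  Unique-rotate : ∀ {x : A} {xs} → Unique (x ∷ xs) → Unique (xs ∷ʳ x)
  Unique-rotate (x∉xs ∷ u) = ++⁺ u ([] ∷ []) λ { (v∈xs , here refl) → All¬⇒¬Any x∉xs v∈xs }

  Unique⇒NonBacktracking-closed : ∀ {x y z : A} {l} → Unique (x ∷ y ∷ z ∷ l) →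
    NonBacktracking (x ∷ (y ∷ z ∷ l) ∷ʳ x)
  Unique⇒NonBacktracking-closed u@((_ ∷ x≢z ∷ _) ∷ _) = x≢z ∷ Unique⇒NonBacktracking (Unique-rotate u)

  Linked-endpoints : ∀ {R : A → A → Set} → (∀ {u v w} → R u v → R v w → R u w) →
    ∀ {x xs w} → Linked R (x ∷ xs ∷ʳ w) → R x w
  Linked-endpoints R-trans l = proj₂ (∷ʳ⁻ (AllPairs.head (Linked⇒AllPairs R-trans l)))

module RootedTree {n : ℕ} (G : Rel n) (G-sym : ∀ {u v} → G u v → G v u)
  (r : Fin n) (par : Fin n → Fin n) (rank : Fin n → ℕ)
  (rank-par : ∀ {v} → v ≢ r → rank (par v) < rank v)
  (G-par : ∀ {v} → v ≢ r → G v (par v)) where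

  ChildOf : Rel n
  ChildOf u v = u ≢ r × par u ≡ v

  Edge : Rel n
  Edge u v = ChildOf u v ⊎ ChildOf v u

  parent-unique : ∀ {u v w} → ChildOf u v → ChildOf u w → v ≡ w
  parent-unique (_ , refl) (_ , refl) = refl

  rank-child : ∀ {u v} → ChildOf u v → rank v < rank u
  rank-child (u≢r , refl) = rank-par u≢r

  Edge⇒G : ∀ {u v} → Edge u v → G u v
  Edge⇒G (inj₁ (u≢r , refl)) = G-par u≢r
  Edge⇒G (inj₂ (v≢r , refl)) = G-sym (G-par v≢r)

  walk-to-root : ∀ {k} u → rank u < k → Walk Edge u r
  walk-to-root u (s≤s rank≤k) with u ≟ r
  ... | yes refl = here
  ... | no u≢r = step (inj₁ (u≢r , refl)) (walk-to-root (par u) (<-≤-trans (rank-par u≢r) rank≤k))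

  no-closed-descent : ∀ {x} xs → ¬ Linked (flip ChildOf) (x ∷ xs ∷ʳ x)
  no-closed-descent xs l = <-irrefl refl (Linked-endpoints <-trans (Linked.map rank-child l))

  no-closed-ascent : ∀ {x} xs → ¬ Linked ChildOf (x ∷ xs ∷ʳ x)
  no-closed-ascent xs l = <-irrefl refl (Linked-endpoints (flip <-trans) (Linked.map rank-child l))

  -- y has a single parent, so a walk entering y from its parent and leaving
  -- towards its parent would backtrack.
  extend-descent : ∀ {x y z} → ChildOf y x → Edge y z → x ≢ z → ChildOf z y
  extend-descent y◁x (inj₁ y◁z) x≢z = contradiction (parent-unique y◁x y◁z) x≢z
  extend-descent y◁x (inj₂ z◁y) x≢z = z◁y

  extend-ascent : ∀ {x y z} → Edge x y → ChildOf y z → x ≢ z → ChildOf x y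
  extend-ascent (inj₁ x◁y) y◁z x≢z = x◁y
  extend-ascent (inj₂ y◁x) y◁z x≢z = contradiction (parent-unique y◁x y◁z) x≢z

  descent-persists : ∀ {x y l} → Linked Edge (x ∷ y ∷ l) → NonBacktracking (x ∷ y ∷ l) →
    ChildOf y x → Linked (flip ChildOf) (x ∷ y ∷ l)
  descent-persists (_ ∷ [-]) _ y◁x = y◁x ∷ [-]
  descent-persists (_ ∷ walk@(e ∷ _)) (x≢z ∷ nb) y◁x =
    y◁x ∷ descent-persists walk nb (extend-descent y◁x e x≢z)

  ascent-extends : ∀ {x y w} ys → Edge x y → Linked ChildOf (y ∷ ys ∷ʳ w) →
    NonBacktracking (x ∷ y ∷ ys ∷ʳ w) → ChildOf x y
  ascent-extends []      e (y◁ ∷ _) (x≢ ∷ _) = extend-ascent e y◁ x≢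
  ascent-extends (_ ∷ _) e (y◁ ∷ _) (x≢ ∷ _) = extend-ascent e y◁ x≢

  ascent-or-final-descent : ∀ x xs {w} → Linked Edge (x ∷ xs ∷ʳ w) →
    NonBacktracking (x ∷ xs ∷ʳ w) → Linked ChildOf (x ∷ xs ∷ʳ w) ⊎ Any (ChildOf w) (x ∷ xs)
  ascent-or-final-descent x [] (inj₁ x◁w ∷ [-]) _ = inj₁ (x◁w ∷ [-])
  ascent-or-final-descent x [] (inj₂ w◁x ∷ [-]) _ = inj₂ (here w◁x)
  ascent-or-final-descent x (y ∷ ys) (e ∷ walk) nb with ascent-or-final-descent y ys walk (tail nb)
  ... | inj₁ ascent = inj₁ (ascent-extends ys e ascent nb ∷ ascent)
  ... | inj₂ final = inj₂ (there final)

  -- Going around from x₀: if the first step descends, every step does;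
  -- otherwise either every step ascends, or the last step descends into x₀ from
  -- its parent, which is then x₁ again.
  closed-walk-revisits : ∀ {x₀ x₁ c} cs → Linked Edge (x₀ ∷ (x₁ ∷ c ∷ cs) ∷ʳ x₀) →
    NonBacktracking (x₀ ∷ (x₁ ∷ c ∷ cs) ∷ʳ x₀) → ¬ All (x₁ ≢_) (c ∷ cs)
  closed-walk-revisits {c = c} cs walk nb x₁∉ with Linked.head walk
  ... | inj₂ x₁◁x₀ = no-closed-descent (_ ∷ c ∷ cs) (descent-persists walk nb x₁◁x₀)
  ... | inj₁ x₀◁x₁ with ascent-or-final-descent c cs (Linked.tail (Linked.tail walk)) (tail (tail nb))
  ...   | inj₁ ascent = no-closed-ascent (_ ∷ c ∷ cs)
            (x₀◁x₁ ∷ ascent-extends cs (Linked.head (Linked.tail walk)) ascent (tail nb) ∷ ascent)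
  ...   | inj₂ final = All¬⇒¬Any x₁∉ (Any.map (parent-unique x₀◁x₁) final)

  acyclic : ∀ xs → ¬ IsCycle Edge xs
  acyclic [] (_ , () , _)
  acyclic (_ ∷ []) (_ , s≤s () , _)
  acyclic (_ ∷ _ ∷ []) (_ , s≤s (s≤s ()) , _)
  acyclic (_ ∷ _ ∷ _ ∷ cs) (unique , _ , walk) =
    closed-walk-revisits cs walk (Unique⇒NonBacktracking-closed unique) (AllPairs.head (AllPairs.tail unique))

  spanningTree : Tree G
  spanningTree = record
    { V = λ _ → ⊤
    ; E = Edge
    ; E-sub = Edge⇒G
    ; E-sym = swap
    ; E-V = λ _ → tt , tt
    ; connected = λ {u} {v} _ _ → walk-to-root u ≤-refl ◅◅ reverse swap (walk-to-root v ≤-refl)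
    ; acyclic = acyclic
    }

  module Colouring {m : ℕ} (κ : Fin n → Fin m)
    (κ-parent : ∀ {u v w} → ChildOf u v → ChildOf v w → κ u ≢ κ v)
    (κ-siblings : ∀ {u v w} → ChildOf u v → ChildOf w v → u ≢ w → κ u ≢ κ w) where

    -- Each tree edge gets the label of its endpoint farther from the root; rank
    -- ties never occur on tree edges, so κ r there is only a placeholder.
    edgeColour : Fin n → Fin n → Fin m
    edgeColour u v with rank u <? rank v | rank v <? rank u
    ... | yes _ | _     = κ v
    ... | no _  | yes _ = κ u
    ... | no _  | no _  = κ r

    edgeColour-sym : ∀ u v → edgeColour u v ≡ edgeColour v u
    edgeColour-sym u v with rank u <? rank v | rank v <? rank u
    ... | yes p | yes q = ⊥-elim (<-asym p q)
    ... | yes _ | no _  = refl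
    ... | no _  | yes _ = refl
    ... | no _  | no _  = refl

    colouring : EdgeColouring n m
    colouring = record { col = edgeColour ; col-sym = edgeColour-sym }

    edgeColour-child : ∀ {u v} → ChildOf u v → edgeColour u v ≡ κ u
    edgeColour-child {u} {v} u◁v with rank u <? rank v | rank v <? rank u
    ... | yes p | _     = ⊥-elim (<-asym p (rank-child u◁v))
    ... | no _  | yes _ = refl
    ... | no _  | no q  = ⊥-elim (q (rank-child u◁v))

    edgeColour-parent : ∀ {u v} → ChildOf v u → edgeColour u v ≡ κ v
    edgeColour-parent {u} {v} v◁u = trans (edgeColour-sym u v) (edgeColour-child v◁u)

    proper : ProperTree colouring spanningTree
    proper u v w (inj₁ u◁v) (inj₁ v◁w) _ eq =
      κ-parent u◁v v◁w (trans (sym (edgeColour-child u◁v)) (trans eq (edgeColour-child v◁w)))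
    proper u v w (inj₁ u◁v) (inj₂ w◁v) u≢w eq =
      κ-siblings u◁v w◁v u≢w (trans (sym (edgeColour-child u◁v)) (trans eq (edgeColour-parent w◁v)))
    proper u v w (inj₂ v◁u) (inj₁ v◁w) u≢w _ = u≢w (parent-unique v◁u v◁w)
    proper u v w (inj₂ v◁u) (inj₂ w◁v) _ eq =
      κ-parent w◁v v◁u (trans (sym (edgeColour-parent w◁v)) (trans (sym eq) (edgeColour-parent v◁u)))

delete : ∀ {m} → Fin (suc (suc m)) → Fin (suc (suc m)) → Fin (suc m)
delete p x with p ≟ x
... | yes _ = fzero
... | no p≢x = punchOut p≢x

delete-injective : ∀ {m} {p x y : Fin (suc (suc m))} → p ≢ x → p ≢ y → delete p x ≡ delete p y → x ≡ y
delete-injective {p = p} {x} {y} p≢x p≢y eq with p ≟ x | p ≟ y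
... | yes p≡x | _       = contradiction p≡x p≢x
... | no _    | yes p≡y = contradiction p≡y p≢y
... | no p≢x′ | no p≢y′ = punchOut-injective p≢x′ p≢y′ eq

delete-≢ : ∀ {m} {p x y : Fin (suc (suc m))} → p ≢ x → p ≢ y → x ≢ y → delete p x ≢ delete p y
delete-≢ p≢x p≢y x≢y = x≢y ∘ delete-injective p≢x p≢y

another : ∀ {m} → Fin (suc (suc m)) → Fin (suc (suc m))
another fzero = fsuc fzero
another (fsuc _) = fzero

another-≢ : ∀ {m} (i : Fin (suc (suc m))) → another i ≢ i
another-≢ fzero ()
another-≢ (fsuc _) ()

-- The spanning tree of a star with centre z in which the leaf s₁ is re-hung
-- below t₁ and the leaf s₂ below t₂ (possibly t₂ = s₁).
record Rehanging {n : ℕ} (G : Rel n) (z : Fin n) : Set where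
  field
    s₁ t₁ s₂ t₂ : Fin n
    s₁≢z : s₁ ≢ z
    s₂≢z : s₂ ≢ z
    s₁≢s₂ : s₁ ≢ s₂
    t₁≢z : t₁ ≢ z
    t₁≢s₁ : t₁ ≢ s₁
    t₁≢s₂ : t₁ ≢ s₂
    t₂≢z : t₂ ≢ z
    t₂≢s₂ : t₂ ≢ s₂
    t₁≢t₂ : t₁ ≢ t₂
    s₁t₁ : G s₁ t₁
    s₂t₂ : G s₂ t₂

module RehungStar {N : ℕ} {G : Rel (5 + N)} (G-sym : ∀ {u v} → G u v → G v u)
  {z : Fin (5 + N)} (G-star : ∀ {x} → x ≢ z → G x z) (R : Rehanging G z) where

  open Rehanging R

  V : Set
  V = Fin (5 + N)

  Spoke : V → Set
  Spoke x = x ≢ z × x ≢ s₁ × x ≢ s₂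

  data Role (x : V) : Set where
    centre : x ≡ z → Role x
    hung₁  : x ≡ s₁ → Role x
    hung₂  : x ≡ s₂ → Role x
    spoke  : Spoke x → Role x

  role : ∀ x → Role x
  role x with x ≟ z | x ≟ s₁ | x ≟ s₂
  ... | yes x≡z | _        | _        = centre x≡z
  ... | no _    | yes x≡s₁ | _        = hung₁ x≡s₁
  ... | no _    | no _     | yes x≡s₂ = hung₂ x≡s₂
  ... | no x≢z  | no x≢s₁  | no x≢s₂  = spoke (x≢z , x≢s₁ , x≢s₂)

  par : V → V
  par x with role x
  ... | centre _ = z
  ... | hung₁ _  = t₁
  ... | hung₂ _  = t₂
  ... | spoke _  = z

  rank : V → ℕ
  rank x with role x
  ... | centre _ = 0
  ... | hung₁ _  = 2
  ... | hung₂ _  = 3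
  ... | spoke _  = 1

  rank-centre : rank z ≡ 0
  rank-centre with role z
  ... | centre _ = refl
  ... | hung₁ e  = contradiction (sym e) s₁≢z
  ... | hung₂ e  = contradiction (sym e) s₂≢z
  ... | spoke (z≢z , _) = contradiction refl z≢z

  rank-≤1 : ∀ {x} → x ≢ s₁ → x ≢ s₂ → rank x ≤ 1
  rank-≤1 {x} x≢s₁ x≢s₂ with role x
  ... | centre _ = z≤n
  ... | hung₁ e  = contradiction e x≢s₁
  ... | hung₂ e  = contradiction e x≢s₂
  ... | spoke _  = ≤-refl

  rank-≤2 : ∀ {x} → x ≢ s₂ → rank x ≤ 2
  rank-≤2 {x} x≢s₂ with role x
  ... | centre _ = z≤n
  ... | hung₁ _  = ≤-refl
  ... | hung₂ e  = contradiction e x≢s₂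
  ... | spoke _  = s≤s z≤n

  rank-par : ∀ {v} → v ≢ z → rank (par v) < rank v
  rank-par {v} v≢z with role v
  ... | centre e = contradiction e v≢z
  ... | hung₁ _  = s≤s (rank-≤1 t₁≢s₁ t₁≢s₂)
  ... | hung₂ _  = s≤s (rank-≤2 t₂≢s₂)
  ... | spoke _  = s≤s (≤-reflexive rank-centre)

  G-par : ∀ {v} → v ≢ z → G v (par v)
  G-par {v} v≢z with role v
  ... | centre e = contradiction e v≢z
  ... | hung₁ refl = s₁t₁
  ... | hung₂ refl = s₂t₂
  ... | spoke _ = G-star v≢z

  par≡z⇒spoke : ∀ {u} → u ≢ z → par u ≡ z → Spoke u
  par≡z⇒spoke {u} u≢z pu≡z with role u
  ... | centre e = contradiction e u≢z
  ... | hung₁ _  = contradiction pu≡z t₁≢z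
  ... | hung₂ _  = contradiction pu≡z t₂≢z
  ... | spoke s  = s

  par≢z⇒rehung : ∀ {u} → u ≢ z → par u ≢ z → (u ≡ s₁ × par u ≡ t₁) ⊎ (u ≡ s₂ × par u ≡ t₂)
  par≢z⇒rehung {u} u≢z pu≢z with role u
  ... | centre e = contradiction e u≢z
  ... | hung₁ e  = inj₁ (e , refl)
  ... | hung₂ e  = inj₂ (e , refl)
  ... | spoke _  = contradiction refl pu≢z

  par-injective : ∀ {u w} → u ≢ z → w ≢ z → par u ≢ z → par u ≡ par w → u ≡ w
  par-injective u≢z w≢z pu≢z pu≡pw with par≢z⇒rehung u≢z pu≢z | par≢z⇒rehung w≢z (pu≢z ∘ trans pu≡pw)
  ... | inj₁ (refl , _) | inj₁ (refl , _) = refl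
  ... | inj₂ (refl , _) | inj₂ (refl , _) = refl
  ... | inj₁ (_ , p) | inj₂ (_ , q) = contradiction (trans (sym p) (trans pu≡pw q)) t₁≢t₂
  ... | inj₂ (_ , p) | inj₁ (_ , q) = contradiction (trans (sym q) (trans (sym pu≡pw) p)) t₁≢t₂

  Colour : Set
  Colour = Fin (2 + N)

  -- Removing z, s₁ and s₂ one at a time leaves exactly n ∸ 3 colours, one per spoke.
  skip₁ : V → Fin (4 + N)
  skip₁ = delete z

  skip₂ : V → Fin (3 + N)
  skip₂ x = delete (skip₁ s₁) (skip₁ x)

  κ₀ : V → Colour
  κ₀ x = delete (skip₂ s₂) (skip₂ x)

  skip₁-≢ : ∀ {x y} → x ≢ z → y ≢ z → x ≢ y → skip₁ x ≢ skip₁ y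
  skip₁-≢ x≢z y≢z = delete-≢ (≢-sym x≢z) (≢-sym y≢z)

  skip₂-≢ : ∀ {x y} → x ≢ z → x ≢ s₁ → y ≢ z → y ≢ s₁ → x ≢ y → skip₂ x ≢ skip₂ y
  skip₂-≢ x≢z x≢s₁ y≢z y≢s₁ =
    delete-≢ (skip₁-≢ s₁≢z x≢z (≢-sym x≢s₁)) (skip₁-≢ s₁≢z y≢z (≢-sym y≢s₁)) ∘ skip₁-≢ x≢z y≢z

  κ₀-injective : ∀ {x y} → Spoke x → Spoke y → κ₀ x ≡ κ₀ y → x ≡ y
  κ₀-injective (x≢z , x≢s₁ , x≢s₂) (y≢z , y≢s₁ , y≢s₂) =
    delete-injective (≢-sym x≢z) (≢-sym y≢z)
    ∘ delete-injective (skip₁-≢ s₁≢z x≢z (≢-sym x≢s₁)) (skip₁-≢ s₁≢z y≢z (≢-sym y≢s₁))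
    ∘ delete-injective (skip₂-≢ s₂≢z (≢-sym s₁≢s₂) x≢z x≢s₁ (≢-sym x≢s₂))
                       (skip₂-≢ s₂≢z (≢-sym s₁≢s₂) y≢z y≢s₁ (≢-sym y≢s₂))

  κ₁ : V → Colour
  κ₁ = updateAt κ₀ s₁ (λ _ → another (κ₀ t₁))

  κ : V → Colour
  κ = updateAt κ₁ s₂ (λ _ → another (κ₁ t₂))

  κ-spoke : ∀ {x} → Spoke x → κ x ≡ κ₀ x
  κ-spoke {x} (_ , x≢s₁ , x≢s₂) = trans (updateAt-minimal x s₂ κ₁ x≢s₂) (updateAt-minimal x s₁ κ₀ x≢s₁)

  κ-s₁ : κ s₁ ≢ κ t₁
  κ-s₁ eq = another-≢ (κ₀ t₁) (begin
    another (κ₀ t₁) ≡⟨ updateAt-updates s₁ κ₀ ⟨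
    κ₁ s₁           ≡⟨ updateAt-minimal s₁ s₂ κ₁ s₁≢s₂ ⟨
    κ s₁            ≡⟨ eq ⟩
    κ t₁            ≡⟨ κ-spoke (t₁≢z , t₁≢s₁ , t₁≢s₂) ⟩
    κ₀ t₁           ∎)
    where open ≡-Reasoning

  κ-s₂ : κ s₂ ≢ κ t₂
  κ-s₂ eq = another-≢ (κ₁ t₂) (begin
    another (κ₁ t₂) ≡⟨ updateAt-updates s₂ κ₁ ⟨
    κ s₂            ≡⟨ eq ⟩
    κ t₂            ≡⟨ updateAt-minimal t₂ s₂ κ₁ t₂≢s₂ ⟩
    κ₁ t₂           ∎)
    where open ≡-Reasoning

  open RootedTree G G-sym z par rank rank-par G-par

  κ-parent : ∀ {u v w} → ChildOf u v → ChildOf v w → κ u ≢ κ v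
  κ-parent {u} (u≢z , refl) (pu≢z , _) with par≢z⇒rehung u≢z pu≢z
  ... | inj₁ (refl , p) = κ-s₁ ∘ λ eq → trans eq (cong κ p)
  ... | inj₂ (refl , p) = κ-s₂ ∘ λ eq → trans eq (cong κ p)

  κ-siblings : ∀ {u v w} → ChildOf u v → ChildOf w v → u ≢ w → κ u ≢ κ w
  κ-siblings {u} {_} {w} (u≢z , refl) (w≢z , pw≡pu) u≢w κu≡κw with par u ≟ z
  ... | no pu≢z = u≢w (par-injective u≢z w≢z pu≢z (sym pw≡pu))
  ... | yes pu≡z = u≢w (κ₀-injective spoke-u spoke-w (begin
    κ₀ u ≡⟨ κ-spoke spoke-u ⟨
    κ u  ≡⟨ κu≡κw ⟩
    κ w  ≡⟨ κ-spoke spoke-w ⟩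
    κ₀ w ∎))
    where
    open ≡-Reasoning
    spoke-u = par≡z⇒spoke u≢z pu≡z
    spoke-w = par≡z⇒spoke w≢z (trans pw≡pu pu≡z)

  open Colouring κ κ-parent κ-siblings

  px≤n∸3 : ∀ k → pxk≤ G k (2 + N)
  px≤n∸3 = properSpanningTree⇒pxk≤ colouring spanningTree (λ _ → tt) proper

module _ {n : ℕ} {z a b c d : Fin n} where

  SPP-sym : ∀ {u v} → SPP z a b c d u v → SPP z a b c d v u
  SPP-sym (inj₁ (p , q)) = inj₂ (inj₁ (p , q))
  SPP-sym (inj₂ (inj₁ (p , q))) = inj₁ (p , q)
  SPP-sym (inj₂ (inj₂ (inj₁ (p , q)))) = inj₂ (inj₂ (inj₂ (inj₁ (q , p))))
  SPP-sym (inj₂ (inj₂ (inj₂ (inj₁ (p , q))))) = inj₂ (inj₂ (inj₁ (q , p)))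
  SPP-sym (inj₂ (inj₂ (inj₂ (inj₂ (inj₁ (p , q)))))) = inj₂ (inj₂ (inj₂ (inj₂ (inj₂ (q , p)))))
  SPP-sym (inj₂ (inj₂ (inj₂ (inj₂ (inj₂ (p , q)))))) = inj₂ (inj₂ (inj₂ (inj₂ (inj₁ (q , p)))))

  SPP-star : ∀ {x} → x ≢ z → SPP z a b c d x z
  SPP-star x≢z = inj₂ (inj₁ (refl , x≢z))

  SPP-ab : SPP z a b c d a b
  SPP-ab = inj₂ (inj₂ (inj₁ (refl , refl)))

  SPP-cd : SPP z a b c d c d
  SPP-cd = inj₂ (inj₂ (inj₂ (inj₂ (inj₁ (refl , refl)))))

-- For a path x – y – w of leaves: the tree z – x – y – w.
path : ∀ {n} {G : Rel n} {z x y w : Fin n} → x ≢ z → y ≢ z → w ≢ z → x ≢ y → x ≢ w → y ≢ w →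
  G y x → G w y → Rehanging G z
path x≢z y≢z w≢z x≢y x≢w y≢w yx wy = record
  { s₁ = _ ; t₁ = _ ; s₂ = _ ; t₂ = _
  ; s₁≢z = y≢z ; s₂≢z = w≢z ; s₁≢s₂ = y≢w ; t₁≢z = x≢z ; t₁≢s₁ = x≢y ; t₁≢s₂ = x≢w
  ; t₂≢z = y≢z ; t₂≢s₂ = y≢w ; t₁≢t₂ = x≢y ; s₁t₁ = yx ; s₂t₂ = wy }

SPP-rehanging : ∀ {n} {z a b c d : Fin n} → a ≢ z → b ≢ z → c ≢ z → d ≢ z → a ≢ b → c ≢ d →
  ¬ (c ≡ a × d ≡ b) → ¬ (c ≡ b × d ≡ a) → Rehanging (SPP z a b c d) z
SPP-rehanging {z = z} {a} {b} {c} {d} a≢z b≢z c≢z d≢z a≢b c≢d ¬ab ¬ba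
  with c ≟ a | c ≟ b | d ≟ a | d ≟ b
... | yes refl | _ | _ | _ =
  path b≢z a≢z d≢z (≢-sym a≢b) (λ b≡d → ¬ab (refl , sym b≡d)) c≢d SPP-ab (SPP-sym SPP-cd)
... | no _ | yes refl | _ | _ =
  path a≢z b≢z d≢z a≢b (λ a≡d → ¬ba (refl , sym a≡d)) c≢d (SPP-sym SPP-ab) (SPP-sym SPP-cd)
... | no c≢a | no c≢b | yes refl | _ =
  path b≢z a≢z c≢z (≢-sym a≢b) (≢-sym c≢b) (≢-sym c≢a) SPP-ab SPP-cd
... | no c≢a | no c≢b | no _ | yes refl =
  path a≢z b≢z c≢z a≢b (≢-sym c≢a) (≢-sym c≢b) (SPP-sym SPP-ab) SPP-cd
... | no c≢a | no c≢b | no _ | no d≢b = record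
  { s₁ = a ; t₁ = b ; s₂ = c ; t₂ = d
  ; s₁≢z = a≢z ; s₂≢z = c≢z ; s₁≢s₂ = ≢-sym c≢a ; t₁≢z = b≢z ; t₁≢s₁ = ≢-sym a≢b ; t₁≢s₂ = ≢-sym c≢b
  ; t₂≢z = d≢z ; t₂≢s₂ = ≢-sym c≢d ; t₁≢t₂ = ≢-sym d≢b ; s₁t₁ = SPP-ab ; s₂t₂ = SPP-cd }

lemma4p1 : (n : ℕ) → 5 ≤ n → (z a b c d : Fin n) →
    a ≢ z → b ≢ z → c ≢ z → d ≢ z → a ≢ b → c ≢ d →
    ¬ (c ≡ a × d ≡ b) → ¬ (c ≡ b × d ≡ a) →
    (k : ℕ) → 3 ≤ k → k ≤ n →
    pxk≤ (SPP z a b c d) k (n ∸ 3)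
lemma4p1 (suc (suc (suc (suc (suc N))))) (s≤s (s≤s (s≤s (s≤s (s≤s z≤n))))) z a b c d
  a≢z b≢z c≢z d≢z a≢b c≢d ¬ab ¬ba k _ _ =
  RehungStar.px≤n∸3 SPP-sym SPP-star (SPP-rehanging a≢z b≢z c≢z d≢z a≢b c≢d ¬ab ¬ba) k
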